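{- There exist graphs embeddable on $\mathbb{N}_4$ with bondage number $8$, and there exist graphs embeddable on $\mathbb{S}_2$ with bondage number $8$. One such graph (for both surfaces) is $K_8\circ K_1$.
   Context: $\mathbb{S}_2$ is the orientable surface of genus $2$ and $\mathbb{N}_4$ the non-orientable surface of genus $4$. The corona $G_1\circ G_2$ is formed from one copy of $G_1$ and $|V(G_1)|$ copies of $G_2$, the $i$th vertex of $G_1$ being joined to every vertex of the $i$th copy of $G_2$. The bondage number $b(G)$ is the smallest number of edges whose removal from $G$ results in a graph with larger domination number. -}

module Defs where

open import Data.Nat using (ℕ; zero; suc; _+_; _*_; _∸_; _≤_; _<_; _<ᵇ_)
open import Data.Bool using (Bool; true; false; not; _∧_; _xor_; if_then_else_; T)
open import Data.Fin using (Fin; zero; suc; toℕ; splitAt; quotient; remainder)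
open import Data.Fin.Subset using (Subset; _∈_; ∣_∣)
open import Data.List using (List; []; _∷_; map; allFin)
open import Data.Nat.ListAction using (sum)
open import Data.Product using (Σ; _×_; _,_; proj₁; proj₂)
open import Data.Sum using (_⊎_; inj₁; inj₂)
open import Relation.Binary.PropositionalEquality using (_≡_; refl; subst; cong₂)

eqᵇ : ∀ {n} → Fin n → Fin n → Bool
eqᵇ zero    zero    = true
eqᵇ zero    (suc _) = false
eqᵇ (suc _) zero    = false
eqᵇ (suc i) (suc j) = eqᵇ i j

eqᵇ-sym : ∀ {n} (i j : Fin n) → eqᵇ i j ≡ eqᵇ j i
eqᵇ-sym zero    zero    = refl
eqᵇ-sym zero    (suc _) = refl
eqᵇ-sym (suc _) zero    = refl
eqᵇ-sym (suc i) (suc j) = eqᵇ-sym i j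

eqᵇ-refl : ∀ {n} (i : Fin n) → eqᵇ i i ≡ true
eqᵇ-refl zero    = refl
eqᵇ-refl (suc i) = eqᵇ-refl i

record Graph (n : ℕ) : Set where
  field
    adj     : Fin n → Fin n → Bool
    adj-sym : ∀ u v → adj u v ≡ adj v u
    adj-irr : ∀ u → adj u u ≡ false
open Graph public

edgeCount : ∀ {n} → Graph n → ℕ
edgeCount {n} G =
  sum (map (λ u → sum (map (λ v → if (toℕ u <ᵇ toℕ v) ∧ adj G u v then 1 else 0)
                            (allFin n)))
           (allFin n))

K : (n : ℕ) → Graph n
K n = record { adj = λ u v → not (eqᵇ u v)
             ; adj-sym = λ u v → subst (λ b → not (eqᵇ u v) ≡ not b) (eqᵇ-sym u v) refl
             ; adj-irr = λ u → subst (λ b → not b ≡ false) (subst (λ b → true ≡ b) refl (symm (eqᵇ-refl u))) refl }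
  where
    symm : ∀ {x y : Bool} → x ≡ y → y ≡ x
    symm refl = refl

-- Corona G₁ ∘ G₂ : vertex set Fin (n₁ + n₁ * n₂); the first n₁ vertices are
-- G₁, a vertex p of the remaining block lies in copy (quotient {n₁} n₂ p) of G₂
-- at position (remainder n₂ p).

module _ {n₁ n₂ : ℕ} (G₁ : Graph n₁) (G₂ : Graph n₂) where

  coronaAdj′ : Fin n₁ ⊎ Fin (n₁ * n₂) → Fin n₁ ⊎ Fin (n₁ * n₂) → Bool
  coronaAdj′ (inj₁ i) (inj₁ j) = adj G₁ i j
  coronaAdj′ (inj₁ i) (inj₂ q) = eqᵇ i (quotient {n₁} n₂ q)
  coronaAdj′ (inj₂ p) (inj₁ j) = eqᵇ (quotient {n₁} n₂ p) j
  coronaAdj′ (inj₂ p) (inj₂ q) =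
    eqᵇ (quotient {n₁} n₂ p) (quotient {n₁} n₂ q) ∧ adj G₂ (remainder {n₁} n₂ p) (remainder {n₁} n₂ q)

  coronaAdj′-sym : ∀ x y → coronaAdj′ x y ≡ coronaAdj′ y x
  coronaAdj′-sym (inj₁ i) (inj₁ j) = adj-sym G₁ i j
  coronaAdj′-sym (inj₁ i) (inj₂ q) = eqᵇ-sym i (quotient {n₁} n₂ q)
  coronaAdj′-sym (inj₂ p) (inj₁ j) = eqᵇ-sym (quotient {n₁} n₂ p) j
  coronaAdj′-sym (inj₂ p) (inj₂ q) =
    cong₂ _∧_ (eqᵇ-sym (quotient {n₁} n₂ p) (quotient {n₁} n₂ q))
              (adj-sym G₂ (remainder {n₁} n₂ p) (remainder {n₁} n₂ q))

  coronaAdj′-irr : ∀ x → coronaAdj′ x x ≡ false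
  coronaAdj′-irr (inj₁ i) = adj-irr G₁ i
  coronaAdj′-irr (inj₂ p) rewrite eqᵇ-refl (quotient {n₁} n₂ p) = adj-irr G₂ (remainder {n₁} n₂ p)

  corona : Graph (n₁ + n₁ * n₂)
  corona = record
    { adj     = λ x y → coronaAdj′ (splitAt n₁ x) (splitAt n₁ y)
    ; adj-sym = λ x y → coronaAdj′-sym (splitAt n₁ x) (splitAt n₁ y)
    ; adj-irr = λ x → coronaAdj′-irr (splitAt n₁ x)
    }

_∘ᶜ_ : ∀ {n₁ n₂} → Graph n₁ → Graph n₂ → Graph (n₁ + n₁ * n₂)
G₁ ∘ᶜ G₂ = corona G₁ G₂

Dominating : ∀ {n} → Graph n → Subset n → Set
Dominating {n} G S = ∀ v → v ∈ S ⊎ Σ (Fin n) (λ u → u ∈ S × T (adj G u v))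

IsDominationNumber : ∀ {n} → Graph n → ℕ → Set
IsDominationNumber {n} G k =
  Σ (Subset n) (λ S → Dominating G S × ∣ S ∣ ≡ k) × (∀ S → Dominating G S → k ≤ ∣ S ∣)

_⊆ᴱ_ : ∀ {n} → Graph n → Graph n → Set
H ⊆ᴱ G = ∀ u v → T (adj H u v) → T (adj G u v)

removed : ∀ {n} → Graph n → Graph n → ℕ
removed G H = edgeCount G ∸ edgeCount H

IsBondageNumber : ∀ {n} → Graph n → ℕ → Set
IsBondageNumber {n} G b =
  Σ ℕ λ γ → IsDominationNumber G γ
    × Σ (Graph n) (λ H → H ⊆ᴱ G × removed G H ≡ b
                         × Σ ℕ (λ γH → IsDominationNumber H γH × γ < γH))
    × (∀ H → H ⊆ᴱ G → removed G H < b → ∀ γH → IsDominationNumber H γH → γH ≤ γ)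

Dart : ∀ {n} → Graph n → Set
Dart {n} G = Σ (Fin n × Fin n) (λ p → T (adj G (proj₁ p) (proj₂ p)))

tl hd : ∀ {n} {G : Graph n} → Dart G → Fin n
tl ((u , _) , _) = u
hd ((_ , v) , _) = v

rev : ∀ {n} {G : Graph n} → Dart G → Dart G
rev {G = G} ((u , v) , t) = (v , u) , subst T (adj-sym G u v) t

Walk : ∀ {n} (G : Graph n) → Fin n → Fin n → List (Dart G) → Set
Walk G u v []       = u ≡ v
Walk G u v (d ∷ ds) = tl {G = G} d ≡ u × Walk G (hd {G = G} d) v ds

Connected : ∀ {n} → Graph n → Set
Connected {n} G = ∀ (u v : Fin n) → Σ (List (Dart G)) (Walk G u v)

iter : ∀ {A : Set} → (A → A) → ℕ → A → A
iter f zero    x = x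
iter f (suc k) x = f (iter f k x)

-- General embedding schemes (rotation system + edge signatures), cf.
-- Mohar–Thomassen, "Graphs on Surfaces", §3.2–3.3.

record Scheme {n} (G : Graph n) : Set where
  field
    rot      : Dart G → Dart G
    rot⁻     : Dart G → Dart G
    rot-left : ∀ d → rot⁻ (rot d) ≡ d
    rot-right : ∀ d → rot (rot⁻ d) ≡ d
    rot-tl   : ∀ d → tl {G = G} (rot d) ≡ tl {G = G} d
    rot-cyc  : ∀ d e → tl {G = G} d ≡ tl {G = G} e → Σ ℕ (λ k → iter rot k d ≡ e)
    sgn      : Dart G → Bool             -- true = negative (twisted) edge
    sgn-rev  : ∀ d → sgn (rev {G = G} d) ≡ sgn d
open Scheme public

module _ {n} {G : Graph n} (σ : Scheme G) where

  -- face-tracing states: (dart being traversed, current local orientation)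
  State : Set
  State = Dart G × Bool

  faceStep : State → State
  faceStep (d , s) =
    (if s xor sgn σ d then rot σ (rev {G = G} d) else rot⁻ σ (rev {G = G} d)) , (s xor sgn σ d)

  -- the same facial walk traversed backwards
  faceRev : State → State
  faceRev (d , s) = rev {G = G} d , not (s xor sgn σ d)

  -- a surjective labelling by Fin F constant on facial walks: witnesses
  -- that the scheme has at least F faces
  AtLeastFaces : ℕ → Set
  AtLeastFaces F =
    Σ (State → Fin F) λ f → (∀ x → f (faceStep x) ≡ f x) × (∀ x → f (faceRev x) ≡ f x)
                           × (∀ i → Σ State (λ x → f x ≡ i))

  negCount : List (Dart G) → ℕ
  negCount ds = sum (map (λ d → if sgn σ d then 1 else 0) ds)

  NonorientableScheme : Set
  NonorientableScheme =
    Σ (Fin n) λ u → Σ (List (Dart G)) λ ds → Walk G u u ds × Σ ℕ (λ m → negCount ds ≡ suc (2 * m))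

-- Embeddability of a CONNECTED graph in S_g / N_k (Euler's formula:
-- Euler genus of the scheme's surface = 2 - n + |E| - #faces).

ConnEmbedsOrientable : ∀ {n} → Graph n → ℕ → Set
ConnEmbedsOrientable {n} G g =
  Connected G ×
  (edgeCount G ≡ 0 ⊎
   Σ (Scheme G) λ σ → (∀ d → sgn σ d ≡ false) ×
     Σ ℕ λ F → AtLeastFaces σ F × edgeCount G + 2 ≤ n + F + 2 * g)

ConnEmbedsNonorientable : ∀ {n} → Graph n → ℕ → Set
ConnEmbedsNonorientable {n} G k =
  Connected G ×
  (edgeCount G ≡ 0 ⊎
   Σ (Scheme G) λ σ → Σ ℕ λ F → AtLeastFaces σ F ×
     ((NonorientableScheme σ × edgeCount G + 2 ≤ n + F + k)
      ⊎ edgeCount G + 3 ≤ n + F + k))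

-- In K_n ∘ K_1 every dominating set meets each pair {hub k, pendant k}, so γ = n, attained by the hubs.
-- Deleting the n edges at one hub isolates it together with its pendant and forces γ = n + 1. Conversely,
-- after deleting fewer than n edges, take every hub that kept its pendant edge and the pendant of every hub
-- that lost it: a hub left undominated would have lost its pendant edge and, for each other hub j, either
-- the pendant edge of j or the edge to j, which makes n distinct deleted edges. So b(K_n ∘ K_1) = n.
-- K_8 ∘ K_1 has 16 vertices and 36 edges, so by Euler's formula a scheme with 18 faces has Euler genus 4:
-- explicit rotation schemes with 18 faces, one untwisted and one with a twisted triangle, are checked by
-- computation.
module Submission where

open import Defs
open import Data.Bool using (Bool; true; false; not; _∧_; _∨_; _xor_; if_then_else_; T)
open import Data.Bool.ListAction using (any)
open import Data.Bool.Properties using (T-≡; T-∧; T?; T-irrelevant; ∧-comm) renaming (_≟_ to _≟ᵇ_)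
open import Data.Fin using (Fin; zero; suc; toℕ; _↑ˡ_; _↑ʳ_; splitAt)
open import Data.Fin.Properties
  using (_≟_; all?; any?; toℕ<n; toℕ-injective; toℕ-↑ˡ; toℕ-↑ʳ; ↑ˡ-injective; ↑ʳ-injective;
         splitAt⁻¹-↑ˡ; splitAt⁻¹-↑ʳ)
open import Data.Fin.Subset using (Subset; _∈_; ∣_∣; ∁; ⊤; ⁅_⁆; _-_; inside; outside)
open import Data.Fin.Subset.Properties
  using (∣∁p∣≡n∸∣p∣; ∣p∣≤n; ∣⊤∣≡n; ∣⁅x⁆∣≡1; drop-there; ∈⊤; x∈⁅x⁆; x∈p⇒∣p-x∣<∣p∣; x∈p∧x≢y⇒x∈p-y)
open import Data.List using (List; []; _∷_; _++_; map; length; reverse; allFin; cartesianProduct)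
open import Data.List.Properties using (map-++; map-∘; length-map; length-tabulate)
open import Data.List.Membership.Propositional using () renaming (_∈_ to _∈ₗ_)
open import Data.List.Membership.Propositional.Properties
  using (∈-∃++; ∈-++⁻; ∈-++⁺ˡ; ∈-++⁺ʳ; ∈-allFin; ∈-cartesianProduct⁺)
open import Data.List.Relation.Binary.Subset.Propositional using (_⊆_)
open import Data.List.Relation.Unary.All as All using (All; []; _∷_)
open import Data.List.Relation.Unary.All.Properties using (map⁺; tabulate⁺)
open import Data.List.Relation.Unary.Any using (here; there)
open import Data.List.Relation.Unary.Unique.Propositional using (Unique; []; _∷_)
import Data.List.Relation.Unary.Unique.Propositional.Properties as Unique
open import Data.Nat using (ℕ; zero; suc; _+_; _≤_; _<_; _<ᵇ_; z≤n; s≤s)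
open import Data.Nat.Properties
  using (≤-refl; ≤-reflexive; ≤-trans; <-≤-trans; ≤-<-trans; +-comm; +-suc; +-mono-≤; +-monoʳ-≤; +-monoʳ-<;
         n≤1+n; n<1+n; m≤m+n; m+[n∸m]≡n; m+n≤o⇒m≤o∸n; n∸n≡0; <ᵇ⇒<; <⇒<ᵇ; ≤∧≢⇒<; ≮⇒≥; <⇒≢; <⇒≱;
         module ≤-Reasoning)
open import Data.Nat.ListAction using (sum)
open import Data.Nat.ListAction.Properties using (sum-++)
open import Data.Nat.Tactic.RingSolver using (solve-∀)
open import Data.Product using (Σ; ∃; _×_; _,_; proj₁; proj₂)
open import Data.Sum using (_⊎_; inj₁; inj₂; map₂) renaming (map to map-⊎)
open import Data.Unit using (tt)
open import Data.Vec using (Vec; []; _∷_; here; there)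
import Data.Vec as Vec
open import Data.Vec.Properties using (lookup∘tabulate; lookup-map; lookup⇒[]=)
open import Function using (_∘_; id; Equivalence)
open import Relation.Nullary using (¬_; yes; no; contradiction)
open import Relation.Nullary.Decidable
  using (Dec; does; map′; dec-true; dec-false; toWitness; ¬?; _×-dec_; _→-dec_)
open import Relation.Binary.PropositionalEquality

sum-map-mono : ∀ {A : Set} {f g : A → ℕ} → (∀ x → f x ≤ g x) → ∀ xs → sum (map f xs) ≤ sum (map g xs)
sum-map-mono f≤g []       = z≤n
sum-map-mono f≤g (x ∷ xs) = +-mono-≤ (f≤g x) (sum-map-mono f≤g xs)

sum-map-++-∷ : ∀ {A : Set} (f : A → ℕ) xs y zs → sum (map f (xs ++ y ∷ zs)) ≡ f y + sum (map f (xs ++ zs))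
sum-map-++-∷ f []       y zs = refl
sum-map-++-∷ f (x ∷ xs) y zs = begin
  f x + sum (map f (xs ++ y ∷ zs))   ≡⟨ cong (f x +_) (sum-map-++-∷ f xs y zs) ⟩
  f x + (f y + sum (map f (xs ++ zs))) ≡⟨ swap (f x) (f y) _ ⟩
  f y + (f x + sum (map f (xs ++ zs))) ∎
  where
    open ≡-Reasoning
    swap : ∀ a b c → a + (b + c) ≡ b + (a + c)
    swap = solve-∀

∈-++-∷⁻ : ∀ {A : Set} {v w : A} xs {ys} → v ∈ₗ xs ++ w ∷ ys → v ≢ w → v ∈ₗ xs ++ ys
∈-++-∷⁻ xs v∈ v≢w with ∈-++⁻ xs v∈
... | inj₁ v∈xs         = ∈-++⁺ˡ v∈xs
... | inj₂ (here v≡w)   = contradiction v≡w v≢w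
... | inj₂ (there v∈ys) = ∈-++⁺ʳ xs v∈ys

sum-map-+-length-≤ : ∀ {A : Set} {f g : A → ℕ} → (∀ x → f x ≤ g x) →
                     ∀ (ws xs : List A) → Unique ws → ws ⊆ xs → All (λ w → f w < g w) ws →
                     length ws + sum (map f xs) ≤ sum (map g xs)
sum-map-+-length-≤ f≤g [] xs _ _ _ = sum-map-mono f≤g xs
sum-map-+-length-≤ {f = f} {g} f≤g (w ∷ ws) xs (w∉ws ∷ unique) ws⊆xs (fw<gw ∷ f<g)
  with ∈-∃++ (ws⊆xs (here refl))
... | ys , zs , refl = begin
  suc (length ws) + sum (map f (ys ++ w ∷ zs))   ≡⟨ cong (suc (length ws) +_) (sum-map-++-∷ f ys w zs) ⟩
  suc (length ws) + (f w + sum (map f (ys ++ zs))) ≡⟨ shuffle (length ws) (f w) _ ⟩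
  suc (f w) + (length ws + sum (map f (ys ++ zs))) ≤⟨ +-mono-≤ fw<gw rest ⟩
  g w + sum (map g (ys ++ zs))                     ≡⟨ sum-map-++-∷ g ys w zs ⟨
  sum (map g (ys ++ w ∷ zs))                       ∎
  where
    open ≤-Reasoning
    shuffle : ∀ l a b → suc l + (a + b) ≡ suc a + (l + b)
    shuffle = solve-∀
    rest : length ws + sum (map f (ys ++ zs)) ≤ sum (map g (ys ++ zs))
    rest = sum-map-+-length-≤ f≤g ws (ys ++ zs) unique
             (λ {v} v∈ws → ∈-++-∷⁻ ys (ws⊆xs (there v∈ws)) λ v≡w → All.lookup w∉ws v∈ws (sym v≡w))
             f<g

sum-map-cartesianProduct : ∀ {A B : Set} (f : A × B → ℕ) xs ys →
  sum (map f (cartesianProduct xs ys)) ≡ sum (map (λ x → sum (map (λ y → f (x , y)) ys)) xs)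
sum-map-cartesianProduct f []       ys = refl
sum-map-cartesianProduct f (x ∷ xs) ys = begin
  sum (map f (map (x ,_) ys ++ cartesianProduct xs ys))
    ≡⟨ cong sum (map-++ f (map (x ,_) ys) _) ⟩
  sum (map f (map (x ,_) ys) ++ map f (cartesianProduct xs ys))
    ≡⟨ sum-++ (map f (map (x ,_) ys)) _ ⟩
  sum (map f (map (x ,_) ys)) + sum (map f (cartesianProduct xs ys))
    ≡⟨ cong₂ _+_ (cong sum (sym (map-∘ ys))) (sum-map-cartesianProduct f xs ys) ⟩
  sum (map (λ y → f (x , y)) ys) + sum (map (λ x → sum (map (λ y → f (x , y)) ys)) xs) ∎
  where open ≡-Reasoning

¬T⇒≡false : ∀ {b} → ¬ T b → b ≡ false
¬T⇒≡false {false} _  = refl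
¬T⇒≡false {true}  ¬t = contradiction _ ¬t

edgeIndicator : ∀ {n} → Graph n → Fin n × Fin n → ℕ
edgeIndicator X (u , v) = if (toℕ u <ᵇ toℕ v) ∧ adj X u v then 1 else 0

edgeCount-indicator : ∀ {n} (X : Graph n) →
  edgeCount X ≡ sum (map (edgeIndicator X) (cartesianProduct (allFin n) (allFin n)))
edgeCount-indicator {n} X = sym (sum-map-cartesianProduct (edgeIndicator X) (allFin n) (allFin n))

edgeIndicator-mono : ∀ {n} {G H : Graph n} → H ⊆ᴱ G → ∀ e → edgeIndicator H e ≤ edgeIndicator G e
edgeIndicator-mono {G = G} {H} H⊆G (u , v) with toℕ u <ᵇ toℕ v | adj H u v in uv∈H
... | false | _     = z≤n
... | true  | false = z≤n
... | true  | true with adj G u v | H⊆G u v (Equivalence.from T-≡ uv∈H)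
...   | true | _ = ≤-refl

LostEdge : ∀ {n} → Graph n → Graph n → Fin n × Fin n → Set
LostEdge G H (u , v) = toℕ u < toℕ v × T (adj G u v) × ¬ T (adj H u v)

edgeIndicator-lost : ∀ {n} {G H : Graph n} e → LostEdge G H e → edgeIndicator H e < edgeIndicator G e
edgeIndicator-lost {G = G} {H} (u , v) (u<v , uv∈G , uv∉H)
  rewrite Equivalence.to T-≡ (<⇒<ᵇ u<v) | Equivalence.to T-≡ uv∈G | ¬T⇒≡false uv∉H = s≤s z≤n

removed-≥ : ∀ {n} {G H : Graph n} → H ⊆ᴱ G →
            ∀ es → Unique es → All (LostEdge G H) es → length es ≤ removed G H
removed-≥ {n} {G} {H} H⊆G es unique lost = m+n≤o⇒m≤o∸n (length es) (begin
  length es + edgeCount H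
    ≡⟨ cong (length es +_) (edgeCount-indicator H) ⟩
  length es + sum (map (edgeIndicator H) allPairs)
    ≤⟨ sum-map-+-length-≤ (edgeIndicator-mono {G = G} {H} H⊆G) es allPairs unique
         (λ {(u , v)} _ → ∈-cartesianProduct⁺ (∈-allFin u) (∈-allFin v))
         (All.map (λ {e} → edgeIndicator-lost {G = G} {H} e) lost) ⟩
  sum (map (edgeIndicator G) allPairs)
    ≡⟨ edgeCount-indicator G ⟨
  edgeCount G ∎)
  where
    open ≤-Reasoning
    allPairs = cartesianProduct (allFin n) (allFin n)

sortPair : ∀ {n} → Fin n → Fin n → Fin n × Fin n
sortPair a b = if toℕ a <ᵇ toℕ b then (a , b) else (b , a)

sortPair-cases : ∀ {n} (a b : Fin n) → sortPair a b ≡ (a , b) ⊎ sortPair a b ≡ (b , a)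
sortPair-cases a b with toℕ a <ᵇ toℕ b
... | true  = inj₁ refl
... | false = inj₂ refl

sortPair-ordered : ∀ {n} {a b : Fin n} → a ≢ b → toℕ (proj₁ (sortPair a b)) < toℕ (proj₂ (sortPair a b))
sortPair-ordered {a = a} {b} a≢b with toℕ a <ᵇ toℕ b in a<ᵇb
... | true  = <ᵇ⇒< _ _ (Equivalence.from T-≡ a<ᵇb)
... | false = ≤∧≢⇒< (≮⇒≥ λ a<b → subst T a<ᵇb (<⇒<ᵇ a<b)) λ b≡a → a≢b (toℕ-injective (sym b≡a))

sortPair-injectiveʳ : ∀ {n} {a b c : Fin n} → sortPair a b ≡ sortPair a c → b ≡ c
sortPair-injectiveʳ {a = a} {b} {c} eq with sortPair-cases a b | sortPair-cases a c
... | inj₁ ab | inj₁ ac = cong proj₂ (trans (sym ab) (trans eq ac))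
... | inj₁ ab | inj₂ ca = let e = trans (sym ab) (trans eq ca) in trans (cong proj₂ e) (cong proj₁ e)
... | inj₂ ba | inj₁ ac = let e = trans (sym ba) (trans eq ac) in trans (cong proj₁ e) (cong proj₂ e)
... | inj₂ ba | inj₂ ca = cong proj₁ (trans (sym ba) (trans eq ca))

sortPair-lost : ∀ {n} {G H : Graph n} {a b : Fin n} → a ≢ b →
                T (adj G a b) → ¬ T (adj H a b) → LostEdge G H (sortPair a b)
sortPair-lost {G = G} {H} {a} {b} a≢b ab∈G ab∉H with sortPair-ordered a≢b | sortPair-cases a b
... | ordered | inj₁ ab rewrite ab = ordered , ab∈G , ab∉H
... | ordered | inj₂ ba rewrite ba =
  ordered , subst T (adj-sym G a b) ab∈G , ab∉H ∘ subst T (adj-sym H b a)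

∣++∣ : ∀ {m k} (p : Subset m) (q : Subset k) → ∣ p Vec.++ q ∣ ≡ ∣ p ∣ + ∣ q ∣
∣++∣ []            q = refl
∣++∣ (inside ∷ p)  q = cong suc (∣++∣ p q)
∣++∣ (outside ∷ p) q = ∣++∣ p q

∣p∣+∣∁p∣≡n : ∀ {n} (p : Subset n) → ∣ p ∣ + ∣ ∁ p ∣ ≡ n
∣p∣+∣∁p∣≡n p = trans (cong (∣ p ∣ +_) (∣∁p∣≡n∸∣p∣ p)) (m+[n∸m]≡n (∣p∣≤n p))

∣p∣+∣q∣-covering : ∀ {m} (p q : Subset m) → (∀ k → k ∈ p ⊎ k ∈ q) → m ≤ ∣ p ∣ + ∣ q ∣
∣p∣+∣q∣-covering []            []            _     = z≤n
∣p∣+∣q∣-covering (x ∷ p)       (y ∷ q)       cover with cover zero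
  | ∣p∣+∣q∣-covering p q (λ k → map-⊎ drop-there drop-there (cover (suc k)))
∣p∣+∣q∣-covering (inside ∷ p)  (inside ∷ q)  _ | _ | rest = s≤s (≤-trans rest (+-monoʳ-≤ ∣ p ∣ (n≤1+n ∣ q ∣)))
∣p∣+∣q∣-covering (inside ∷ p)  (outside ∷ q) _ | _ | rest = s≤s rest
∣p∣+∣q∣-covering (outside ∷ p) (inside ∷ q)  _ | _ | rest =
  ≤-trans (s≤s rest) (≤-reflexive (sym (+-suc ∣ p ∣ ∣ q ∣)))
∣p∣+∣q∣-covering (outside ∷ p) (outside ∷ q) _ | inj₁ () | _
∣p∣+∣q∣-covering (outside ∷ p) (outside ∷ q) _ | inj₂ () | _

∣p∣+∣q∣-covering-twice : ∀ {m} (p q : Subset m) {r} → r ∈ p → r ∈ q → (∀ k → k ∈ p ⊎ k ∈ q) →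
                         suc m ≤ ∣ p ∣ + ∣ q ∣
∣p∣+∣q∣-covering-twice p q {r} r∈p r∈q cover =
  ≤-<-trans (∣p∣+∣q∣-covering p (q - r) cover-r) (+-monoʳ-< ∣ p ∣ (x∈p⇒∣p-x∣<∣p∣ r∈q))
  where
    cover-r : ∀ k → k ∈ p ⊎ k ∈ q - r
    cover-r k with k ≟ r
    ... | yes refl = inj₁ r∈p
    ... | no k≢r   = map₂ (λ k∈q → x∈p∧x≢y⇒x∈p-y k∈q k≢r) (cover k)

↑ˡ-∈-++⁻ : ∀ {m k} {p : Subset m} {q : Subset k} i → i ↑ˡ k ∈ p Vec.++ q → i ∈ p
↑ˡ-∈-++⁻ {p = _ ∷ _} zero    here      = here
↑ˡ-∈-++⁻ {p = _ ∷ _} (suc i) (there h) = there (↑ˡ-∈-++⁻ i h)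

↑ʳ-∈-++⁻ : ∀ {m k} (p : Subset m) {q : Subset k} {i} → m ↑ʳ i ∈ p Vec.++ q → i ∈ q
↑ʳ-∈-++⁻ []      h         = h
↑ʳ-∈-++⁻ (_ ∷ p) (there h) = ↑ʳ-∈-++⁻ p h

↑ˡ-∈-++⁺ : ∀ {m k} {p : Subset m} {q : Subset k} {i} → i ∈ p → i ↑ˡ k ∈ p Vec.++ q
↑ˡ-∈-++⁺ here      = here
↑ˡ-∈-++⁺ (there h) = there (↑ˡ-∈-++⁺ h)

↑ʳ-∈-++⁺ : ∀ {m k} (p : Subset m) {q : Subset k} {i} → i ∈ q → m ↑ʳ i ∈ p Vec.++ q
↑ʳ-∈-++⁺ []      h = h
↑ʳ-∈-++⁺ (_ ∷ p) h = there (↑ʳ-∈-++⁺ p h)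

isolate : ∀ {n} → Graph n → Fin n → Graph n
isolate X w = record
  { adj     = λ u v → adj X u v ∧ (not (does (u ≟ w)) ∧ not (does (v ≟ w)))
  ; adj-sym = λ u v → cong₂ _∧_ (adj-sym X u v) (∧-comm (not (does (u ≟ w))) _)
  ; adj-irr = λ u → cong (_∧ _) (adj-irr X u)
  }

isolate-⊆ᴱ : ∀ {n} (X : Graph n) w → isolate X w ⊆ᴱ X
isolate-⊆ᴱ X w u v = proj₁ ∘ Equivalence.to T-∧

isolate-isolated : ∀ {n} (X : Graph n) w u → ¬ T (adj (isolate X w) u w)
isolate-isolated X w u uw =
  subst (T ∘ not) (dec-true (w ≟ w) refl)
    (proj₂ (Equivalence.to T-∧ (proj₂ (Equivalence.to (T-∧ {adj X u w}) uw))))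

isolate-keeps : ∀ {n} (X : Graph n) {w u v} → u ≢ w → v ≢ w → T (adj X u v) → T (adj (isolate X w) u v)
isolate-keeps X {w} {u} {v} u≢w v≢w uv = Equivalence.from T-∧ (uv , Equivalence.from T-∧
  (subst (T ∘ not) (sym (dec-false (u ≟ w) u≢w)) _ , subst (T ∘ not) (sym (dec-false (v ≟ w) v≢w)) _))

isolated-∈ : ∀ {n} {X : Graph n} {S v} → (∀ u → ¬ T (adj X u v)) → Dominating X S → v ∈ S
isolated-∈ {v = v} isolated dominating with dominating v
... | inj₁ v∈S            = v∈S
... | inj₂ (u , _ , u~v) = contradiction u~v (isolated u)

walk-++ : ∀ {n} {G : Graph n} {u v w ds es} → Walk G u v ds → Walk G v w es → Walk G u w (ds ++ es)
walk-++ {ds = []}    refl        q = q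
walk-++ {ds = _ ∷ _} (refl , p) q = refl , walk-++ p q

walk-reverse : ∀ {n} {G : Graph n} {u v} ds → Walk G u v ds → ∃ (Walk G v u)
walk-reverse []                  refl       = [] , refl
walk-reverse {G = G} (d ∷ ds) (refl , p) with walk-reverse ds p
... | es , q = es ++ rev {G = G} d ∷ [] , walk-++ q (refl , refl)

connected-from : ∀ {n} {G : Graph n} r → (∀ v → ∃ (Walk G r v)) → Connected G
connected-from r reach u v with reach u | reach v
... | ds , r→u | es , r→v with walk-reverse ds r→u
...   | ds′ , u→r = ds′ ++ es , walk-++ u→r r→v

module Corona (n : ℕ) where

  hub pend : Fin n → Fin (n + n)
  hub k = k ↑ˡ n
  pend k = n ↑ʳ k

  hub<pend : ∀ (i j : Fin n) → toℕ (hub i) < toℕ (pend j)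
  hub<pend i j = subst₂ _<_ (sym (toℕ-↑ˡ i n)) (sym (toℕ-↑ʳ n j)) (<-≤-trans (toℕ<n i) (m≤m+n n (toℕ j)))

  hub≢pend : ∀ {i j : Fin n} → hub i ≢ pend j
  hub≢pend {i = i} {j} eq = <⇒≢ (hub<pend i j) (cong toℕ eq)

  data HubOrPend : Fin (n + n) → Set where
    is-hub  : ∀ k → HubOrPend (hub k)
    is-pend : ∀ k → HubOrPend (pend k)

  hubOrPend : ∀ (v : Fin (n + n)) → HubOrPend v
  hubOrPend v with splitAt n v in split
  ... | inj₁ k = subst HubOrPend (splitAt⁻¹-↑ˡ split) (is-hub k)
  ... | inj₂ k = subst HubOrPend (splitAt⁻¹-↑ʳ split) (is-pend k)

  Pendants : Graph (n + n) → Set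
  Pendants X = ∀ u k → T (adj X u (pend k)) → u ≡ hub k

  -- G is K_n ∘ K_1 numbered as in Defs.corona: hub k is vertex k of K_n, pend k its pendant, and the
  -- spoke of k is the edge between them.
  record IsCompleteCorona (G : Graph (n + n)) : Set where
    field
      pendants : Pendants G
      spoke    : ∀ k → T (adj G (hub k) (pend k))
      clique   : ∀ {i j} → i ≢ j → T (adj G (hub i) (hub j))
  open IsCompleteCorona

  pendants-⊆ᴱ : ∀ {G H : Graph (n + n)} → H ⊆ᴱ G → Pendants G → Pendants H
  pendants-⊆ᴱ H⊆G pendants u k u~pend = pendants u k (H⊆G u (pend k) u~pend)

  hub-or-pend-∈ : ∀ {X : Graph (n + n)} {S} → Pendants X → Dominating X S → ∀ k → hub k ∈ S ⊎ pend k ∈ S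
  hub-or-pend-∈ pendants dominating k with dominating (pend k)
  ... | inj₁ pend∈S = inj₂ pend∈S
  ... | inj₂ (u , u∈S , u~pend) with pendants u k u~pend
  ...   | refl = inj₁ u∈S

  dominating-size : ∀ {X : Graph (n + n)} {S} → Pendants X → Dominating X S → n ≤ ∣ S ∣
  dominating-size {X} {S} pendants dominating with Vec.splitAt n S
  ... | p , q , refl = subst (n ≤_) (sym (∣++∣ p q)) (∣p∣+∣q∣-covering p q λ k →
    map-⊎ (↑ˡ-∈-++⁻ k) (↑ʳ-∈-++⁻ p) (hub-or-pend-∈ {X} pendants dominating k))

  dominating-size-twice : ∀ {X : Graph (n + n)} {S} → Pendants X → Dominating X S →
                          ∀ r → hub r ∈ S → pend r ∈ S → suc n ≤ ∣ S ∣
  dominating-size-twice {X} {S} pendants dominating r hub∈S pend∈S with Vec.splitAt n S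
  ... | p , q , refl = subst (suc n ≤_) (sym (∣++∣ p q))
    (∣p∣+∣q∣-covering-twice p q (↑ˡ-∈-++⁻ r hub∈S) (↑ʳ-∈-++⁻ p pend∈S) λ k →
      map-⊎ (↑ˡ-∈-++⁻ k) (↑ʳ-∈-++⁻ p) (hub-or-pend-∈ {X} pendants dominating k))

  spokesKept : Graph (n + n) → Subset n
  spokesKept X = Vec.tabulate λ k → adj X (hub k) (pend k)

  coverSet : Graph (n + n) → Subset (n + n)
  coverSet X = spokesKept X Vec.++ ∁ (spokesKept X)

  ∣coverSet∣ : ∀ (X : Graph (n + n)) → ∣ coverSet X ∣ ≡ n
  ∣coverSet∣ X = trans (∣++∣ (spokesKept X) _) (∣p∣+∣∁p∣≡n (spokesKept X))

  hub∈coverSet : ∀ {X : Graph (n + n)} {k} → adj X (hub k) (pend k) ≡ true → hub k ∈ coverSet X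
  hub∈coverSet {X} {k} kept = ↑ˡ-∈-++⁺ (lookup⇒[]= k (spokesKept X) (trans (lookup∘tabulate _ k) kept))

  pend∈coverSet : ∀ {X : Graph (n + n)} {k} → adj X (hub k) (pend k) ≡ false → pend k ∈ coverSet X
  pend∈coverSet {X = X} {k} lost = ↑ʳ-∈-++⁺ (spokesKept X)
    (lookup⇒[]= k _ (trans (lookup-map k not (spokesKept X)) (cong not (trans (lookup∘tabulate _ k) lost))))

  spoke≢sortPair : ∀ {j a b : Fin n} → (hub j , pend j) ≢ sortPair (hub a) (hub b)
  spoke≢sortPair {a = a} {b} eq with sortPair-cases (hub a) (hub b)
  ... | inj₁ ab = hub≢pend (sym (cong proj₂ (trans eq ab)))
  ... | inj₂ ba = hub≢pend (sym (cong proj₂ (trans eq ba)))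

  -- A hub i left undominated by coverSet H costs n lost edges: for each j, the spoke of j or the edge ij.
  module LonelyHub {G H : Graph (n + n)} (corona : IsCompleteCorona G) (H⊆G : H ⊆ᴱ G) (i : Fin n)
                   (spoke-lost : ¬ T (adj H (hub i) (pend i)))
                   (no-kept-neighbour : ∀ j → ¬ (T (adj H (hub j) (pend j)) × T (adj H (hub j) (hub i))))
                   where

    lostEdge : Fin n → Fin (n + n) × Fin (n + n)
    lostEdge j with j ≟ i | adj H (hub j) (pend j)
    ... | no _ | true = sortPair (hub i) (hub j)
    ... | _    | _    = hub j , pend j

    lostEdge-lost : ∀ j → LostEdge G H (lostEdge j)
    lostEdge-lost j with j ≟ i | adj H (hub j) (pend j) in kept
    ... | yes refl | _     = hub<pend i i , spoke corona i , spoke-lost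
    ... | no _     | false = hub<pend j j , spoke corona j , subst T kept
    ... | no j≢i   | true  =
      sortPair-lost {G = G} {H} (j≢i ∘ sym ∘ ↑ˡ-injective n i j) (clique corona (j≢i ∘ sym))
      λ i~j → no-kept-neighbour j (Equivalence.from T-≡ kept , subst T (adj-sym H (hub i) (hub j)) i~j)

    lostEdge-cases : ∀ j → lostEdge j ≡ (hub j , pend j) ⊎ lostEdge j ≡ sortPair (hub i) (hub j)
    lostEdge-cases j with j ≟ i | adj H (hub j) (pend j)
    ... | yes _ | _     = inj₁ refl
    ... | no _  | false = inj₁ refl
    ... | no _  | true  = inj₂ refl

    lostEdge-injective : ∀ {j k} → lostEdge j ≡ lostEdge k → j ≡ k
    lostEdge-injective {j} {k} eq with lostEdge-cases j | lostEdge-cases k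
    ... | inj₁ sj | inj₁ sk = ↑ʳ-injective n j k (cong proj₂ (trans (sym sj) (trans eq sk)))
    ... | inj₁ sj | inj₂ hk = contradiction (trans (sym sj) (trans eq hk)) spoke≢sortPair
    ... | inj₂ hj | inj₁ sk = contradiction (trans (sym sk) (trans (sym eq) hj)) spoke≢sortPair
    ... | inj₂ hj | inj₂ hk = ↑ˡ-injective n j k (sortPair-injectiveʳ (trans (sym hj) (trans eq hk)))

    removed≥n : n ≤ removed G H
    removed≥n = subst (_≤ removed G H) (trans (length-map lostEdge (allFin n)) (length-tabulate id))
      (removed-≥ {G = G} {H} H⊆G (map lostEdge (allFin n)) (Unique.map⁺ lostEdge-injective (Unique.allFin⁺ n))
                     (map⁺ (tabulate⁺ lostEdge-lost)))

  coverSet-dominating : ∀ {G H : Graph (n + n)} → IsCompleteCorona G → H ⊆ᴱ G → removed G H < n →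
                        Dominating H (coverSet H)
  coverSet-dominating {G} {H} corona H⊆G few v with hubOrPend v
  ... | is-pend k with adj H (hub k) (pend k) in kept
  ...   | true  = inj₂ (hub k , hub∈coverSet {H} kept , Equivalence.from T-≡ kept)
  ...   | false = inj₁ (pend∈coverSet {H} kept)
  coverSet-dominating {G} {H} corona H⊆G few v | is-hub k with adj H (hub k) (pend k) in kept
  ...   | true  = inj₁ (hub∈coverSet {H} kept)
  ...   | false with any? (λ j → T? (adj H (hub j) (pend j)) ×-dec T? (adj H (hub j) (hub k)))
  ...     | yes (j , j-kept , j~k) = inj₂ (hub j , hub∈coverSet {H} (Equivalence.to T-≡ j-kept) , j~k)
  ...     | no none = contradiction
    (LonelyHub.removed≥n {G} {H} corona H⊆G k (subst T kept) λ j kept∧adj → none (j , kept∧adj)) (<⇒≱ few)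

  isolate-hub-domination : ∀ {G} → IsCompleteCorona G → ∀ r → IsDominationNumber (isolate G (hub r)) (suc n)
  isolate-hub-domination {G} corona r =
    (⊤ {n} Vec.++ ⁅ r ⁆ , dominates , size)
    , λ S dominating → dominating-size-twice {H₀} (pendants-H₀) dominating r
        (isolated-∈ {X = H₀} (isolate-isolated G (hub r)) dominating)
        (isolated-∈ {X = H₀} pend-isolated dominating)
    where
      H₀ = isolate G (hub r)
      size : ∣ ⊤ {n} Vec.++ ⁅ r ⁆ ∣ ≡ suc n
      size = trans (∣++∣ (⊤ {n}) ⁅ r ⁆) (trans (cong₂ _+_ (∣⊤∣≡n n) (∣⁅x⁆∣≡1 r)) (+-comm n 1))
      pendants-H₀ : Pendants H₀
      pendants-H₀ = pendants-⊆ᴱ {G} {H₀} (isolate-⊆ᴱ G (hub r)) (pendants corona)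
      pend-isolated : ∀ u → ¬ T (adj H₀ u (pend r))
      pend-isolated u u~pend with pendants-H₀ u r u~pend
      ... | refl = isolate-isolated G (hub r) (pend r) (subst T (adj-sym H₀ (hub r) (pend r)) u~pend)
      dominates : Dominating H₀ (⊤ {n} Vec.++ ⁅ r ⁆)
      dominates v with hubOrPend v
      ... | is-hub k  = inj₁ (↑ˡ-∈-++⁺ ∈⊤)
      ... | is-pend k with k ≟ r
      ...   | yes refl = inj₁ (↑ʳ-∈-++⁺ ⊤ (x∈⁅x⁆ r))
      ...   | no k≢r   = inj₂ (hub k , ↑ˡ-∈-++⁺ ∈⊤ ,
                               isolate-keeps G (k≢r ∘ ↑ˡ-injective n k r) (hub≢pend ∘ sym) (spoke corona k))

  complete-corona-bondage : ∀ {G} → IsCompleteCorona G → ∀ r → removed G (isolate G (hub r)) ≡ n →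
                            IsBondageNumber G n
  complete-corona-bondage {G} corona r degree =
    n , ((coverSet G , coverSet-dominating {G} {G} corona (λ _ _ → id) intact , ∣coverSet∣ G)
        , λ S → dominating-size {G} (pendants corona))
      , (isolate G (hub r) , isolate-⊆ᴱ G (hub r) , degree
         , suc n , isolate-hub-domination corona r , n<1+n n)
      , λ H H⊆G few γH (_ , minimal) →
          subst (γH ≤_) (∣coverSet∣ H) (minimal _ (coverSet-dominating {G} {H} corona H⊆G few))
    where
      intact : removed G G < n
      intact = subst (_< n) (sym (n∸n≡0 (edgeCount G))) (≤-<-trans z≤n (toℕ<n r))

  complete-corona-connected : ∀ {G} → IsCompleteCorona G → Fin n → Connected G
  complete-corona-connected {G} corona r = connected-from (hub r) reach
    where
      reach-hub : ∀ k → ∃ (Walk G (hub r) (hub k))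
      reach-hub k with r ≟ k
      ... | yes refl = [] , refl
      ... | no r≢k   = ((hub r , hub k) , clique corona r≢k) ∷ [] , refl , refl
      reach : ∀ v → ∃ (Walk G (hub r) v)
      reach v with hubOrPend v
      ... | is-hub k  = reach-hub k
      ... | is-pend k with reach-hub k
      ...   | ds , r→k = ds ++ ((hub k , pend k) , spoke corona k) ∷ [] , walk-++ r→k (refl , refl)

dart-≡ : ∀ {n} {G : Graph n} {d e : Dart G} → proj₁ d ≡ proj₁ e → d ≡ e
dart-≡ {d = p , t} {.p , t′} refl = cong (p ,_) (T-irrelevant t t′)

record RotationSystem {n} (G : Graph n) : Set where
  field
    next prev   : Fin n → Fin n → Fin n
    signed      : Fin n → Fin n → Bool
    next-adj    : ∀ {u v} → T (adj G u v) → T (adj G u (next u v))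
    prev-adj    : ∀ {u v} → T (adj G u v) → T (adj G u (prev u v))
    prev-next   : ∀ {u v} → T (adj G u v) → prev u (next u v) ≡ v
    next-prev   : ∀ {u v} → T (adj G u v) → next u (prev u v) ≡ v
    next-cyclic : ∀ {u v w} → T (adj G u v) → T (adj G u w) → ∃ λ k → iter (next u) k v ≡ w
    signed-sym  : ∀ {u v} → T (adj G u v) → signed u v ≡ signed v u

module _ {n} {G : Graph n} (R : RotationSystem G) where
  open RotationSystem R

  rotate rotate⁻ : Dart G → Dart G
  rotate  ((u , v) , t) = (u , next u v) , next-adj t
  rotate⁻ ((u , v) , t) = (u , prev u v) , prev-adj t

  iter-rotate : ∀ k {u v} (t : T (adj G u v)) → proj₁ (iter rotate k ((u , v) , t)) ≡ (u , iter (next u) k v)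
  iter-rotate zero    t = refl
  iter-rotate (suc k) t = cong (λ (u , v) → u , next u v) (iter-rotate k t)

  toScheme : Scheme G
  toScheme = record
    { rot       = rotate
    ; rot⁻      = rotate⁻
    ; rot-left  = λ { ((u , v) , t) → dart-≡ {G = G} (cong (u ,_) (prev-next t)) }
    ; rot-right = λ { ((u , v) , t) → dart-≡ {G = G} (cong (u ,_) (next-prev t)) }
    ; rot-tl    = λ _ → refl
    ; rot-cyc   = λ { ((u , v) , t) ((.u , w) , t′) refl →
                      let k , v↝w = next-cyclic t t′
                      in k , dart-≡ {G = G} (trans (iter-rotate k t) (cong (u ,_) v↝w)) }
    ; sgn       = λ d → signed (tl {G = G} d) (hd {G = G} d)
    ; sgn-rev   = λ { ((u , v) , t) → sym (signed-sym t) }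
    }

  -- face u v s names the face traced through the dart u → v with local orientation s.
  faces-from-labelling : ∀ {F} (face : Fin n → Fin n → Bool → Fin F) →
    (∀ {u v} s → T (adj G u v) →
       face v (if s xor signed u v then next v u else prev v u) (s xor signed u v) ≡ face u v s) →
    (∀ {u v} s → T (adj G u v) → face v u (not (s xor signed u v)) ≡ face u v s) →
    (∀ i → ∃ λ u → ∃ λ v → T (adj G u v) × face u v false ≡ i) →
    AtLeastFaces toScheme F
  faces-from-labelling {F} face step reverse onto = label , label-step , label-reverse , label-onto
    where
      label : State toScheme → Fin F
      label (((u , v) , _) , s) = face u v s

      label-step : ∀ x → label (faceStep toScheme x) ≡ label x
      label-step (d@((u , v) , t) , s) = via (s xor signed u v) (step s t)
        where
          via : ∀ c → face v (if c then next v u else prev v u) c ≡ face u v s →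
                label ((if c then rotate (rev {G = G} d) else rotate⁻ (rev {G = G} d)) , c) ≡ face u v s
          via true  e = e
          via false e = e

      label-reverse : ∀ x → label (faceRev toScheme x) ≡ label x
      label-reverse (((u , v) , t) , s) = reverse s t

      label-onto : ∀ i → Σ (State toScheme) λ x → label x ≡ i
      label-onto i with onto i
      ... | u , v , t , e = (((u , v) , t) , false) , e

cyclicSuccessor : ∀ {n} → List (Fin n) → Fin n → Fin n
cyclicSuccessor []             v = v
cyclicSuccessor {n} (x ∷ xs) v = after (x ∷ xs)
  where
    after : List (Fin n) → Fin n
    after (y ∷ z ∷ ys) = if does (y ≟ v) then z else after (z ∷ ys)
    after _            = x

assoc : ∀ {n} {A : Set} → A → List (Fin n × A) → Fin n → A
assoc default []             v = default
assoc default ((u , a) ∷ xs) v = if does (u ≟ v) then a else assoc default xs v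

∀-Bool? : ∀ {P : Bool → Set} → Dec (P true) → Dec (P false) → Dec (∀ s → P s)
∀-Bool? p-true? p-false? =
  map′ (λ (pt , pf) → λ { true → pt ; false → pf }) (λ p → p true , p false) (p-true? ×-dec p-false?)

-- table u lists the neighbours of u in rotation order, each paired with the face containing the corner
-- between it and the next neighbour; zero is a junk face for non-neighbours.
module RotationTable {n F} (G : Graph n) (table : Fin n → List (Fin n × Fin (suc F)))
                     (signed : Fin n → Fin n → Bool) where

  rotation : Fin n → List (Fin n)
  rotation u = map proj₁ (table u)

  next prev : Fin n → Fin n → Fin n
  next u = cyclicSuccessor (rotation u)
  prev u = cyclicSuccessor (reverse (rotation u))

  face : Fin n → Fin n → Bool → Fin (suc F)
  face u v false = assoc zero (table u) v
  face u v true  = assoc zero (table u) (prev u v)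

  FaceStep FaceReverse : Fin n → Fin n → Bool → Set
  FaceStep    u v s = face v (if s xor signed u v then next v u else prev v u) (s xor signed u v) ≡ face u v s
  FaceReverse u v s = face v u (not (s xor signed u v)) ≡ face u v s

  ValidAt : Fin n → Fin n → Set
  ValidAt u v = T (adj G u (next u v)) × T (adj G u (prev u v))
              × prev u (next u v) ≡ v × next u (prev u v) ≡ v × signed u v ≡ signed v u × (∀ s → FaceStep u v s) × (∀ s → FaceReverse u v s)

  Valid : Set
  Valid = (∀ u v → T (adj G u v) → ValidAt u v)
        × (∀ u v w → T (adj G u v) → T (adj G u w) → ∃ λ (k : Fin n) → iter (next u) (toℕ k) v ≡ w)
        × (∀ i → ∃ λ u → ∃ λ v → T (adj G u v) × face u v false ≡ i)

  valid? : Dec Valid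
  valid? = (all? λ u → all? λ v → T? (adj G u v) →-dec validAt? u v)
    ×-dec (all? λ u → all? λ v → all? λ w → T? (adj G u v) →-dec T? (adj G u w) →-dec
             any? λ k → iter (next u) (toℕ k) v ≟ w)
    ×-dec (all? λ i → any? λ u → any? λ v → T? (adj G u v) ×-dec face u v false ≟ i)
    where
      validAt? : ∀ u v → Dec (ValidAt u v)
      validAt? u v = T? (adj G u (next u v)) ×-dec T? (adj G u (prev u v)) ×-dec prev u (next u v) ≟ v
        ×-dec next u (prev u v) ≟ v ×-dec signed u v ≟ᵇ signed v u
        ×-dec ∀-Bool? (faceStep? true) (faceStep? false)
        ×-dec ∀-Bool? (faceReverse? true) (faceReverse? false)
        where
          faceStep? : ∀ s → Dec (FaceStep u v s)
          faceStep? s = _ ≟ _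
          faceReverse? : ∀ s → Dec (FaceReverse u v s)
          faceReverse? s = _ ≟ _

  module _ (valid : Valid) where

    rotationSystem : RotationSystem G
    rotationSystem = record
      { next        = next
      ; prev        = prev
      ; signed      = signed
      ; next-adj    = λ t → let (a , _ , _ , _ , _ , _ , _) = local t in a
      ; prev-adj    = λ t → let (_ , a , _ , _ , _ , _ , _) = local t in a
      ; prev-next   = λ t → let (_ , _ , a , _ , _ , _ , _) = local t in a
      ; next-prev   = λ t → let (_ , _ , _ , a , _ , _ , _) = local t in a
      ; next-cyclic = λ t t′ → let (k , v↝w) = proj₁ (proj₂ valid) _ _ _ t t′ in toℕ k , v↝w
      ; signed-sym  = λ t → let (_ , _ , _ , _ , a , _ , _) = local t in a
      }
      where
        local : ∀ {u v} → T (adj G u v) → ValidAt u v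
        local {u} {v} = proj₁ valid u v

    faces : AtLeastFaces (toScheme rotationSystem) (suc F)
    faces = faces-from-labelling rotationSystem face
      (λ s t → let (_ , _ , _ , _ , _ , a , _) = proj₁ valid _ _ t in a s)
      (λ s t → let (_ , _ , _ , _ , _ , _ , a) = proj₁ valid _ _ t in a s)
      (proj₂ (proj₂ valid))

K₈∘K₁ : Graph 16
K₈∘K₁ = K 8 ∘ᶜ K 1

open Corona 8

corona-K₈∘K₁ : IsCompleteCorona K₈∘K₁
corona-K₈∘K₁ = record
  { pendants = toWitness {a? = all? λ u → all? λ k → T? (adj K₈∘K₁ u (pend k)) →-dec u ≟ hub k} _
  ; spoke    = toWitness {a? = all? λ k → T? (adj K₈∘K₁ (hub k) (pend k))} _
  ; clique   = λ {i} {j} →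
      toWitness {a? = all? λ i → all? λ j → ¬? (i ≟ j) →-dec T? (adj K₈∘K₁ (hub i) (hub j))} _ i j
  }

Vertex FaceName : Set
Vertex   = Fin 16
FaceName = Fin 18

Table : Set
Table = Vec (List (Vertex × FaceName)) 16

twisted : ∀ {n} → List (Fin n × Fin n) → Fin n → Fin n → Bool
twisted es u v = any (λ (a , b) → does (a ≟ u) ∧ does (b ≟ v) ∨ does (a ≟ v) ∧ does (b ≟ u)) es

module Certificates where
  open import Agda.Builtin.FromNat using (Number; fromNat)
  import Data.Fin.Literals as Fin
  import Data.Unit as Unit

  instance
    finNumber : ∀ {n} → Number (Fin n)
    finNumber = Fin.number _
    -- Closes the bound checks True (m <? n) of Fin literals, which reduce to ⊤.
    inRange : Unit.⊤
    inRange = tt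

  tableS₂ : Table
  tableS₂ =
    ((7 , 11) ∷ (8 , 11) ∷ (4 , 2) ∷ (1 , 0) ∷ (2 , 6) ∷ (6 , 16) ∷ (3 , 4) ∷ (5 , 10) ∷ [])
    ∷ ((6 , 8) ∷ (9 , 8) ∷ (5 , 17) ∷ (7 , 12) ∷ (3 , 1) ∷ (2 , 0) ∷ (0 , 2) ∷ (4 , 7) ∷ [])
    ∷ ((7 , 14) ∷ (10 , 14) ∷ (6 , 6) ∷ (0 , 0) ∷ (1 , 1) ∷ (3 , 3) ∷ (4 , 5) ∷ (5 , 13) ∷ [])
    ∷ ((7 , 13) ∷ (11 , 13) ∷ (5 , 4) ∷ (0 , 16) ∷ (6 , 9) ∷ (4 , 3) ∷ (2 , 1) ∷ (1 , 12) ∷ [])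
    ∷ ((6 , 7) ∷ (12 , 7) ∷ (1 , 2) ∷ (0 , 11) ∷ (7 , 15) ∷ (5 , 5) ∷ (2 , 3) ∷ (3 , 9) ∷ [])
    ∷ ((3 , 13) ∷ (13 , 13) ∷ (2 , 5) ∷ (4 , 15) ∷ (7 , 17) ∷ (1 , 8) ∷ (6 , 10) ∷ (0 , 4) ∷ [])
    ∷ ((3 , 16) ∷ (14 , 16) ∷ (0 , 6) ∷ (2 , 14) ∷ (7 , 10) ∷ (5 , 8) ∷ (1 , 7) ∷ (4 , 9) ∷ [])
    ∷ ((1 , 17) ∷ (15 , 17) ∷ (5 , 15) ∷ (4 , 11) ∷ (0 , 10) ∷ (6 , 14) ∷ (2 , 13) ∷ (3 , 12) ∷ [])
    ∷ ((0 , 11) ∷ [])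
    ∷ ((1 , 8) ∷ [])
    ∷ ((2 , 14) ∷ [])
    ∷ ((3 , 13) ∷ [])
    ∷ ((4 , 7) ∷ [])
    ∷ ((5 , 13) ∷ [])
    ∷ ((6 , 16) ∷ [])
    ∷ ((7 , 17) ∷ [])
    ∷ []

  tableN₄ : Table
  tableN₄ =
    ((6 , 12) ∷ (8 , 12) ∷ (3 , 11) ∷ (4 , 2) ∷ (5 , 15) ∷ (2 , 0) ∷ (1 , 6) ∷ (7 , 17) ∷ [])
    ∷ ((4 , 6) ∷ (9 , 6) ∷ (0 , 0) ∷ (2 , 13) ∷ (3 , 8) ∷ (7 , 7) ∷ (5 , 16) ∷ (6 , 14) ∷ [])
    ∷ ((4 , 1) ∷ (10 , 1) ∷ (3 , 13) ∷ (1 , 0) ∷ (0 , 15) ∷ (5 , 10) ∷ (7 , 9) ∷ (6 , 4) ∷ [])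
    ∷ ((1 , 13) ∷ (11 , 13) ∷ (2 , 1) ∷ (4 , 3) ∷ (5 , 5) ∷ (6 , 12) ∷ (0 , 11) ∷ (7 , 8) ∷ [])
    ∷ ((1 , 14) ∷ (12 , 14) ∷ (6 , 4) ∷ (2 , 1) ∷ (3 , 3) ∷ (5 , 2) ∷ (0 , 11) ∷ (7 , 6) ∷ [])
    ∷ ((0 , 15) ∷ (13 , 15) ∷ (2 , 10) ∷ (7 , 7) ∷ (1 , 16) ∷ (6 , 5) ∷ (3 , 3) ∷ (4 , 2) ∷ [])
    ∷ ((5 , 16) ∷ (14 , 16) ∷ (1 , 14) ∷ (4 , 4) ∷ (2 , 9) ∷ (7 , 17) ∷ (0 , 12) ∷ (3 , 5) ∷ [])
    ∷ ((6 , 17) ∷ (15 , 17) ∷ (0 , 6) ∷ (4 , 11) ∷ (3 , 8) ∷ (1 , 7) ∷ (5 , 10) ∷ (2 , 9) ∷ [])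
    ∷ ((0 , 12) ∷ [])
    ∷ ((1 , 6) ∷ [])
    ∷ ((2 , 1) ∷ [])
    ∷ ((3 , 13) ∷ [])
    ∷ ((4 , 14) ∷ [])
    ∷ ((5 , 15) ∷ [])
    ∷ ((6 , 16) ∷ [])
    ∷ ((7 , 17) ∷ [])
    ∷ []

  twistedN₄ : List (Vertex × Vertex)
  twistedN₄ = (0 , 3) ∷ (0 , 5) ∷ (0 , 6) ∷ (1 , 5) ∷ (1 , 6) ∷ (1 , 7) ∷ (2 , 4) ∷ (2 , 5) ∷ (2 , 7)
            ∷ (3 , 4) ∷ (3 , 7) ∷ (4 , 5) ∷ (4 , 6) ∷ (6 , 7) ∷ []

  -- Only its edge 0–3 is twisted.
  triangle : Vertex × Vertex × Vertex
  triangle = 0 , 3 , 1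

open Certificates

module S₂ = RotationTable K₈∘K₁ (Vec.lookup tableS₂) (λ _ _ → false)
module N₄ = RotationTable K₈∘K₁ (Vec.lookup tableN₄) (twisted twistedN₄)

validS₂ : S₂.Valid
validS₂ = toWitness {a? = S₂.valid?} _

validN₄ : N₄.Valid
validN₄ = toWitness {a? = N₄.valid?} _

schemeS₂ schemeN₄ : Scheme K₈∘K₁
schemeS₂ = toScheme (S₂.rotationSystem validS₂)
schemeN₄ = toScheme (N₄.rotationSystem validN₄)

nonorientableN₄ : NonorientableScheme schemeN₄
nonorientableN₄ =
  let (a , b , c) = triangle
  in a , (((a , b) , tt) ∷ ((b , c) , tt) ∷ ((c , a) , tt) ∷ []) , (refl , refl , refl , refl) , 0 , refl

connected : Connected K₈∘K₁
connected = complete-corona-connected corona-K₈∘K₁ zero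

euler : edgeCount K₈∘K₁ + 2 ≤ 16 + 18 + 4
euler = ≤-refl

embedsN₄ : ConnEmbedsNonorientable K₈∘K₁ 4
embedsN₄ = connected , inj₂ (schemeN₄ , 18 , N₄.faces validN₄ , inj₁ (nonorientableN₄ , euler))

embedsS₂ : ConnEmbedsOrientable K₈∘K₁ 2
embedsS₂ = connected , inj₂ (schemeS₂ , (λ _ → refl) , 18 , S₂.faces validS₂ , euler)

proposition5 : ConnEmbedsNonorientable (K 8 ∘ᶜ K 1) 4
             × ConnEmbedsOrientable (K 8 ∘ᶜ K 1) 2
             × IsBondageNumber (K 8 ∘ᶜ K 1) 8
proposition5 = embedsN₄ , embedsS₂ , complete-corona-bondage corona-K₈∘K₁ zero refl
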